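{- For all $n\geq 2$, the number of desarrangements of length $n$ avoiding both $231$ and $321$ is $d_n(231,321)=2^{n-2}$.
   Context: Permutations are in one-line notation. An index $i\in[n-1]$ is a descent of $\pi\in\mathfrak{S}_n$ if $\pi_i>\pi_{i+1}$; $i\in[n]$ is an ascent if it is not a descent (so $n$ is always an ascent). A desarrangement is a permutation whose first ascent is even. $d_n(\Pi)$ is the number of desarrangements in $\mathfrak{S}_n$ avoiding every pattern in $\Pi$ ($\pi$ avoids $\sigma$ if no subsequence of $\pi$ has the same relative order as $\sigma$). -}

module Defs where

open import Data.Nat using (ℕ; zero; suc; _<_; _<?_; _≟_)
open import Data.Nat.Divisibility using (_∣_; _∣?_)
open import Data.Fin using (Fin; toℕ)
open import Data.Fin.Properties using (any?; all?)
open import Data.Vec using (Vec; []; _∷_; lookup)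
open import Data.List using (List; [_]; map; concatMap; allFin; filter; length)
open import Data.Product using (_×_; _,_; ∃)
open import Relation.Nullary using (¬_; Dec)
open import Relation.Nullary.Decidable using (_×-dec_; _→-dec_; ¬?)
open import Relation.Binary.PropositionalEquality using (_≡_)

-- A word of length n over [n] = Fin n (values 0..n-1), in one-line notation.
-- Positions are also 0-based: index i : Fin n is position (toℕ i + 1).
Word : ℕ → Set
Word n = Vec (Fin n) n

_<ᶠ_ : ∀ {n} → Fin n → Fin n → Set
a <ᶠ b = toℕ a < toℕ b

IsPerm : ∀ {n} → Word n → Set
IsPerm {n} π = ∀ (i j : Fin n) → lookup π i ≡ lookup π j → i ≡ j

IsDescent : ∀ {n} → Word n → Fin n → Set
IsDescent {n} π i = ∃ λ (j : Fin n) → (toℕ j ≡ suc (toℕ i)) × (lookup π j <ᶠ lookup π i)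

-- Ascent: not a descent (so the last position is always an ascent).
IsAscent : ∀ {n} → Word n → Fin n → Set
IsAscent π i = ¬ IsDescent π i

-- Desarrangement: the first ascent (1-based position toℕ i + 1) is even.
IsDesarrangement : ∀ {n} → Word n → Set
IsDesarrangement {n} π =
  ∃ λ (i : Fin n) → IsAscent π i
                  × (∀ (j : Fin n) → toℕ j < toℕ i → IsDescent π j)
                  × (2 ∣ suc (toℕ i))

Contains231 : ∀ {n} → Word n → Set
Contains231 {n} π = ∃ λ (i : Fin n) → ∃ λ (j : Fin n) → ∃ λ (k : Fin n) →
  (i <ᶠ j) × (j <ᶠ k) × (lookup π k <ᶠ lookup π i) × (lookup π i <ᶠ lookup π j)

Contains321 : ∀ {n} → Word n → Set
Contains321 {n} π = ∃ λ (i : Fin n) → ∃ λ (j : Fin n) → ∃ λ (k : Fin n) →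
  (i <ᶠ j) × (j <ᶠ k) × (lookup π k <ᶠ lookup π j) × (lookup π j <ᶠ lookup π i)

Counted : ∀ {n} → Word n → Set
Counted π = IsPerm π × IsDesarrangement π × ¬ Contains231 π × ¬ Contains321 π

private
  _<ᶠ?_ : ∀ {n} (a b : Fin n) → Dec (a <ᶠ b)
  a <ᶠ? b = toℕ a <? toℕ b

  _≟ᶠ_ : ∀ {n} (a b : Fin n) → Dec (a ≡ b)
  _≟ᶠ_ = Data.Fin._≟_

isPerm? : ∀ {n} (π : Word n) → Dec (IsPerm π)
isPerm? π = all? λ i → all? λ j → (lookup π i ≟ᶠ lookup π j) →-dec (i ≟ᶠ j)

isDescent? : ∀ {n} (π : Word n) (i : Fin n) → Dec (IsDescent π i)
isDescent? π i = any? λ j → (toℕ j ≟ suc (toℕ i)) ×-dec (lookup π j <ᶠ? lookup π i)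

isDesarrangement? : ∀ {n} (π : Word n) → Dec (IsDesarrangement π)
isDesarrangement? π = any? λ i →
  ¬? (isDescent? π i)
  ×-dec (all? (λ j → (toℕ j <? toℕ i) →-dec isDescent? π j))
  ×-dec (2 ∣? suc (toℕ i))

contains231? : ∀ {n} (π : Word n) → Dec (Contains231 π)
contains231? π = any? λ i → any? λ j → any? λ k →
  (i <ᶠ? j) ×-dec (j <ᶠ? k) ×-dec (lookup π k <ᶠ? lookup π i) ×-dec (lookup π i <ᶠ? lookup π j)

contains321? : ∀ {n} (π : Word n) → Dec (Contains321 π)
contains321? π = any? λ i → any? λ j → any? λ k →
  (i <ᶠ? j) ×-dec (j <ᶠ? k) ×-dec (lookup π k <ᶠ? lookup π j) ×-dec (lookup π j <ᶠ? lookup π i)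

counted? : ∀ {n} (π : Word n) → Dec (Counted π)
counted? π = isPerm? π ×-dec isDesarrangement? π ×-dec ¬? (contains231? π) ×-dec ¬? (contains321? π)

allVecs : (n k : ℕ) → List (Vec (Fin n) k)
allVecs n zero    = [ [] ]
allVecs n (suc k) = concatMap (λ x → map (x ∷_) (allVecs n k)) (allFin n)

d-231-321 : ℕ → ℕ
d-231-321 n = length (filter counted? (allVecs n n))

-- For an injective sequence, avoiding both 231 and 321 says exactly that no entry has two
-- larger entries to its left. In particular the first ascent of such a permutation is at
-- position 1 or 2, so it is a desarrangement iff it starts with a descent. The last entry of
-- such a permutation of [n+1] is n+1 or n (otherwise both would lie to its left), and deleting
-- it and standardising is inverted by raising the entries >= x by one and appending x, for
-- x = n+1 or x = n. Hence the class doubles from length n to n+1, starting from {21} at length 2.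
module Submission where

open import Defs
open import Data.Nat using (ℕ; zero; suc; pred; _+_; _^_; _∸_; _<_; _≤_; z≤n; s≤s; s≤s⁻¹; z<s; s<s; >-nonZero)
open import Data.Nat.Properties
open import Data.Nat.Divisibility using (_∣_; ∣1⇒≡1; ∣-refl)
open import Data.Fin as Fin using (Fin; toℕ; fromℕ<)
open import Data.Fin.Properties using (toℕ<n; toℕ-fromℕ<; toℕ-injective; any?; injective⇒≤; punchOut-injective)
open import Data.Vec using (Vec; []; _∷_; lookup)
open import Data.Vec.Properties using (∷-injective)
open import Data.List using (List; []; _∷_; [_]; _++_; map; length; concatMap; allFin; cartesianProductWith)
open import Data.List.Properties using (length-++; length-map)
open import Data.List.Membership.Propositional using (_∈_)
open import Data.List.Membership.Propositional.Properties using (∈-filter⁺; ∈-filter⁻; ∈-allFin; ∈-cartesianProductWith⁺; ∈-++⁻; ∈-++⁺ˡ; ∈-++⁺ʳ; ∈-map⁺; ∈-map⁻)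
open import Data.List.Membership.Propositional.Properties.WithK using (unique∧set⇒bag)
open import Data.List.Relation.Binary.BagAndSetEquality using (∼bag⇒↭)
open import Data.List.Relation.Binary.Permutation.Propositional.Properties using (↭-length)
open import Data.List.Relation.Unary.Any using (here)
import Data.List.Relation.Unary.All as All
open import Data.List.Relation.Unary.AllPairs using ([]; _∷_)
open import Data.List.Relation.Unary.Unique.Propositional using (Unique)
import Data.List.Relation.Unary.Unique.Propositional.Properties as Unique
open import Data.Product using (∃; _×_; _,_; proj₁; proj₂)
open import Data.Sum using (_⊎_; inj₁; inj₂)
open import Data.Empty using (⊥; ⊥-elim)
open import Function using (_∘_)
open import Function.Bundles using (_⇔_; mk⇔; Equivalence)
open import Function.Properties.Equivalence using () renaming (trans to ⇔-trans; sym to ⇔-sym)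
open import Relation.Nullary using (¬_; yes; no; contradiction)
open import Relation.Binary using (Tri; tri<; tri≈; tri>)
open import Relation.Binary.PropositionalEquality
  using (_≡_; _≢_; refl; sym; trans; cong; cong₂; subst; subst₂; module ≡-Reasoning)

unique∧set⇒length≡ : ∀ {A : Set} {xs ys : List A} → Unique xs → Unique ys →
                      (∀ {z} → z ∈ xs ⇔ z ∈ ys) → length xs ≡ length ys
unique∧set⇒length≡ ux uy same = ↭-length (∼bag⇒↭ (unique∧set⇒bag ux uy same))

allVecs-≡-cartesianProductWith : ∀ n k →
  allVecs n (suc k) ≡ cartesianProductWith _∷_ (allFin n) (allVecs n k)
allVecs-≡-cartesianProductWith n k = go (allFin n)
  where
    go : ∀ xs → concatMap (λ x → map (x ∷_) (allVecs n k)) xs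
              ≡ cartesianProductWith _∷_ xs (allVecs n k)
    go []       = refl
    go (x ∷ xs) = cong (map (x ∷_) (allVecs n k) ++_) (go xs)

allVecs-unique : ∀ n k → Unique (allVecs n k)
allVecs-unique n zero    = All.[] ∷ []
allVecs-unique n (suc k) rewrite allVecs-≡-cartesianProductWith n k =
  Unique.cartesianProductWith⁺ _∷_ ∷-injective (Unique.allFin⁺ n) (allVecs-unique n k)

∈-allVecs : ∀ n k (v : Vec (Fin n) k) → v ∈ allVecs n k
∈-allVecs n zero    []      = here refl
∈-allVecs n (suc k) (x ∷ v) rewrite allVecs-≡-cartesianProductWith n k =
  ∈-cartesianProductWith⁺ _∷_ (∈-allFin x) (∈-allVecs n k v)

d-231-321-≡-length : ∀ n (ws : List (Word n)) → Unique ws →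
                     (∀ {v} → v ∈ ws ⇔ Counted v) → d-231-321 n ≡ length ws
d-231-321-≡-length n ws unique members =
  unique∧set⇒length≡ (Unique.filter⁺ counted? (allVecs-unique n n)) unique
    λ {v} → mk⇔ (λ v∈ → Equivalence.from members (proj₂ (∈-filter⁻ counted? {xs = allVecs n n} v∈)))
                (λ v∈ → ∈-filter⁺ counted? (∈-allVecs n n v) (Equivalence.to members v∈))

Bounded : ℕ → (ℕ → ℕ) → Set
Bounded n f = ∀ {i} → i < n → f i < n

OntoBelow : ℕ → (ℕ → ℕ) → Set
OntoBelow n f = ∀ {y} → y < n → ∃ λ i → i < n × f i ≡ y

InjectiveOn : ℕ → (ℕ → ℕ) → Set
InjectiveOn n f = ∀ {i j} → i < n → j < n → f i ≡ f j → i ≡ j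

OrderPreservingOn : ℕ → (ℕ → ℕ) → (ℕ → ℕ) → Set
OrderPreservingOn n f g = ∀ {i j} → i < n → j < n → f i < f j → g i < g j

AtMostOneLargerBefore : ℕ → (ℕ → ℕ) → Set
AtMostOneLargerBefore n f = ∀ {i j k} → i < j → j < k → k < n → f k < f i → f k < f j → ⊥

<-below : ∀ {i j k n} → i < j → j < k → k < n → i < n × j < n
<-below i<j j<k k<n = <-trans i<j j<n , j<n
  where j<n = <-trans j<k k<n

module _ {n} {f g : ℕ → ℕ} (f-injective : InjectiveOn n f) (f→g : OrderPreservingOn n f g) where

  OrderPreservingOn-reflects : OrderPreservingOn n g f
  OrderPreservingOn-reflects {i} {j} i<n j<n gi<gj with <-cmp (f i) (f j)
  ... | tri< fi<fj _ _ = fi<fj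
  ... | tri≈ _ fi≡fj _ with refl ← f-injective i<n j<n fi≡fj = contradiction gi<gj (<-irrefl refl)
  ... | tri> _ _ fj<fi = contradiction gi<gj (<-asym (f→g j<n i<n fj<fi))

  OrderPreservingOn-injective : InjectiveOn n g
  OrderPreservingOn-injective {i} {j} i<n j<n gi≡gj with <-cmp (f i) (f j)
  ... | tri< fi<fj _ _ = contradiction gi≡gj (<⇒≢ (f→g i<n j<n fi<fj))
  ... | tri≈ _ fi≡fj _ = f-injective i<n j<n fi≡fj
  ... | tri> _ _ fj<fi = contradiction (sym gi≡gj) (<⇒≢ (f→g j<n i<n fj<fi))

-- The relative order of f on [0, n) is that of a {231,321}-avoiding desarrangement
-- (positions are 0-based); that f permutes [0, n) is the separate condition Bounded.
record IsAvoidingDesarrangement (n : ℕ) (f : ℕ → ℕ) : Set where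
  field
    1<n                   : 1 < n
    injective             : InjectiveOn n f
    atMostOneLargerBefore : AtMostOneLargerBefore n f
    startsWithDescent     : f 1 < f 0

open IsAvoidingDesarrangement

transport : ∀ {n f g} → OrderPreservingOn n f g →
            IsAvoidingDesarrangement n f → IsAvoidingDesarrangement n g
transport {n} {f} {g} f→g ad = record
  { 1<n                   = ad .1<n
  ; injective             = OrderPreservingOn-injective (ad .injective) f→g
  ; atMostOneLargerBefore = λ i<j j<k k<n gk<gi gk<gj →
      let i<n , j<n = <-below i<j j<k k<n in
      ad .atMostOneLargerBefore i<j j<k k<n (g→f k<n i<n gk<gi) (g→f k<n j<n gk<gj)
  ; startsWithDescent     = f→g (ad .1<n) (<-trans z<s (ad .1<n)) (ad .startsWithDescent)
  }
  where
    g→f : OrderPreservingOn n g f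
    g→f = OrderPreservingOn-reflects (ad .injective) f→g

pointwise-OrderPreservingOn : ∀ {n f g} → (∀ {i} → i < n → f i ≡ g i) → OrderPreservingOn n f g
pointwise-OrderPreservingOn f≗g i<n j<n = subst₂ _<_ (f≗g i<n) (f≗g j<n)

dropLast : ∀ {n f} → 1 < n → IsAvoidingDesarrangement (suc n) f → IsAvoidingDesarrangement n f
dropLast 1<n′ ad = record
  { 1<n                   = 1<n′
  ; injective             = λ i<n j<n → ad .injective (m<n⇒m<1+n i<n) (m<n⇒m<1+n j<n)
  ; atMostOneLargerBefore = λ i<j j<k k<n → ad .atMostOneLargerBefore i<j j<k (m<n⇒m<1+n k<n)
  ; startsWithDescent     = ad .startsWithDescent
  }

snoc : ∀ {n f} → IsAvoidingDesarrangement n f →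
       (∀ {i} → i < n → f i ≢ f n) →
       (∀ {i j} → i < j → j < n → f n < f i → f n < f j → ⊥) →
       IsAvoidingDesarrangement (suc n) f
snoc {n} {f} ad lastDistinct lastAtMostOneLarger = record
  { 1<n                   = m<n⇒m<1+n (ad .1<n)
  ; injective             = injective′
  ; atMostOneLargerBefore = atMostOneLargerBefore′
  ; startsWithDescent     = ad .startsWithDescent
  }
  where
    injective′ : InjectiveOn (suc n) f
    injective′ i<1+n j<1+n fi≡fj with m<1+n⇒m<n∨m≡n i<1+n | m<1+n⇒m<n∨m≡n j<1+n
    ... | inj₁ i<n  | inj₁ j<n  = ad .injective i<n j<n fi≡fj
    ... | inj₁ i<n  | inj₂ refl = contradiction fi≡fj (lastDistinct i<n)
    ... | inj₂ refl | inj₁ j<n  = contradiction (sym fi≡fj) (lastDistinct j<n)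
    ... | inj₂ refl | inj₂ refl = refl

    atMostOneLargerBefore′ : AtMostOneLargerBefore (suc n) f
    atMostOneLargerBefore′ i<j j<k k<1+n with m<1+n⇒m<n∨m≡n k<1+n
    ... | inj₁ k<n  = ad .atMostOneLargerBefore i<j j<k k<n
    ... | inj₂ refl = lastAtMostOneLarger i<j j<k

punchIn : ℕ → ℕ → ℕ
punchIn x y with y <? x
... | yes _ = y
... | no  _ = suc y

punchOut : ℕ → ℕ → ℕ
punchOut x y with y <? x
... | yes _ = y
... | no  _ = pred y

punchIn-mono-< : ∀ x {y z} → y < z → punchIn x y < punchIn x z
punchIn-mono-< x {y} {z} y<z with y <? x | z <? x
... | yes _   | yes _   = y<z
... | yes _   | no  _   = m<n⇒m<1+n y<z
... | no  y≮x | yes z<x = contradiction (<-trans y<z z<x) y≮x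
... | no  _   | no  _   = s<s y<z

punchIn-injective : ∀ x {y z} → punchIn x y ≡ punchIn x z → y ≡ z
punchIn-injective x {y} {z} eq with <-cmp y z
... | tri< y<z _ _ = contradiction eq (<⇒≢ (punchIn-mono-< x y<z))
... | tri≈ _ y≡z _ = y≡z
... | tri> _ _ z<y = contradiction (sym eq) (<⇒≢ (punchIn-mono-< x z<y))

punchIn-≢ : ∀ x y → punchIn x y ≢ x
punchIn-≢ x y with y <? x
... | yes y<x = <⇒≢ y<x
... | no  y≮x = λ { refl → y≮x (n<1+n y) }

punchIn-< : ∀ {n} x {y} → y < n → punchIn x y < suc n
punchIn-< x {y} y<n with y <? x
... | yes _ = m<n⇒m<1+n y<n
... | no  _ = s<s y<n

<punchIn⇒≤ : ∀ x y → x < punchIn x y → x ≤ y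
<punchIn⇒≤ x y x<y′ with y <? x
... | yes y<x = contradiction x<y′ (<-asym y<x)
... | no  y≮x = ≮⇒≥ y≮x

punchOut-mono-< : ∀ {x y z} → y ≢ x → z ≢ x → y < z → punchOut x y < punchOut x z
punchOut-mono-< {x} {y} {z} y≢x z≢x y<z with y <? x | z <? x
... | yes _   | yes _   = y<z
... | yes y<x | no  z≮x = <-≤-trans y<x (<⇒≤pred (≤∧≢⇒< (≮⇒≥ z≮x) (z≢x ∘ sym)))
... | no  y≮x | yes z<x = contradiction (<-trans y<z z<x) y≮x
... | no  y≮x | no  _   = pred-mono-< {{>-nonZero (≤-<-trans z≤n x<y)}} y<z
  where x<y = ≤∧≢⇒< (≮⇒≥ y≮x) (y≢x ∘ sym)

punchOut-< : ∀ {n x y} → x < suc n → y < suc n → y ≢ x → punchOut x y < n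
punchOut-< {n} {x} {y} x≤n y≤n y≢x with y <? x
... | yes y<x = <-≤-trans y<x (s≤s⁻¹ x≤n)
... | no  y≮x with y | ≤∧≢⇒< (≮⇒≥ y≮x) (y≢x ∘ sym)
...   | suc _ | _ = s≤s⁻¹ y≤n

punchIn-punchOut : ∀ {x y} → y ≢ x → punchIn x (punchOut x y) ≡ y
punchIn-punchOut {x} {y} y≢x with y <? x
... | yes y<x with y <? x
...   | yes _   = refl
...   | no  y≮x = contradiction y<x y≮x
punchIn-punchOut {x} {y} y≢x | no y≮x with y | ≤∧≢⇒< (≮⇒≥ y≮x) (y≢x ∘ sym)
... | suc y′ | x<1+y′ with y′ <? x
...   | yes y′<x = contradiction x<1+y′ (<⇒≱ y′<x ∘ s≤s⁻¹)
...   | no  _    = refl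

extend : ℕ → ℕ → (ℕ → ℕ) → ℕ → ℕ
extend n x g i with i <? n
... | yes _ = punchIn x (g i)
... | no  _ = x

extend-< : ∀ {n x g i} → i < n → extend n x g i ≡ punchIn x (g i)
extend-< {n} {i = i} i<n with i <? n
... | yes _   = refl
... | no  i≮n = contradiction i<n i≮n

extend-last : ∀ n x g → extend n x g n ≡ x
extend-last n x g with n <? n
... | yes n<n = contradiction n<n (<-irrefl refl)
... | no  _   = refl

extend-cong : ∀ {n x g h} → (∀ {i} → i < n → g i ≡ h i) →
              ∀ {i} → i < suc n → extend n x g i ≡ extend n x h i
extend-cong {n} {x} {g} {h} g≗h {i} i≤n with m<1+n⇒m<n∨m≡n i≤n
... | inj₁ i<n  = trans (extend-< i<n) (trans (cong (punchIn x) (g≗h i<n)) (sym (extend-< i<n)))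
... | inj₂ refl = trans (extend-last n x g) (sym (extend-last n x h))

extend-bounded : ∀ {n x g} → Bounded n g → x < suc n → Bounded (suc n) (extend n x g)
extend-bounded {n} {x} {g} g-bounded x≤n {i} i≤n with m<1+n⇒m<n∨m≡n i≤n
... | inj₁ i<n  = subst (_< suc n) (sym (extend-< i<n)) (punchIn-< x (g-bounded i<n))
... | inj₂ refl = subst (_< suc n) (sym (extend-last n x g)) x≤n

extend-IsAvoidingDesarrangement : ∀ {n x g} → Bounded n g → n ≤ suc x →
  IsAvoidingDesarrangement n g → IsAvoidingDesarrangement (suc n) (extend n x g)
extend-IsAvoidingDesarrangement {n} {x} {g} g-bounded n≤1+x ad =
  snoc (transport g→extend ad) lastDistinct lastAtMostOneLarger
  where
    g→extend : OrderPreservingOn n g (extend n x g)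
    g→extend i<n j<n gi<gj =
      subst₂ _<_ (sym (extend-< i<n)) (sym (extend-< j<n)) (punchIn-mono-< x gi<gj)

    lastDistinct : ∀ {i} → i < n → extend n x g i ≢ extend n x g n
    lastDistinct {i} i<n rewrite extend-< {x = x} {g} i<n | extend-last n x g = punchIn-≢ x (g i)

    -- n ≤ 1 + x leaves x as the only value of g that punchIn x moves above x.
    movedAbove : ∀ {i} → i < n → extend n x g n < extend n x g i → g i ≡ x
    movedAbove {i} i<n x<gi′ rewrite extend-< {x = x} {g} i<n | extend-last n x g =
      ≤-antisym (s≤s⁻¹ (≤-trans (g-bounded i<n) n≤1+x)) (<punchIn⇒≤ x (g i) x<gi′)

    lastAtMostOneLarger : ∀ {i j} → i < j → j < n → extend n x g n < extend n x g i →
                          extend n x g n < extend n x g j → ⊥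
    lastAtMostOneLarger i<j j<n above-i above-j =
      <-irrefl (ad .injective i<n j<n (trans (movedAbove i<n above-i) (sym (movedAbove j<n above-j)))) i<j
      where i<n = <-trans i<j j<n

module Decomposition {n f} (f-bounded : Bounded (suc n) f) (ad : IsAvoidingDesarrangement (suc n) f) where

  lastDistinct : ∀ {i} → i < n → f i ≢ f n
  lastDistinct i<n fi≡fn = <-irrefl (ad .injective (m<n⇒m<1+n i<n) (n<1+n n) fi≡fn) i<n

  remainder : ℕ → ℕ
  remainder i = punchOut (f n) (f i)

  remainder-bounded : Bounded n remainder
  remainder-bounded i<n = punchOut-< (f-bounded (n<1+n n)) (f-bounded (m<n⇒m<1+n i<n)) (lastDistinct i<n)

  remainder-IsAvoidingDesarrangement : 1 < n → IsAvoidingDesarrangement n remainder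
  remainder-IsAvoidingDesarrangement 1<n′ = transport f→remainder (dropLast 1<n′ ad)
    where
      f→remainder : OrderPreservingOn n f remainder
      f→remainder i<n j<n = punchOut-mono-< (lastDistinct i<n) (lastDistinct j<n)

  extend-remainder : ∀ {i} → i < suc n → extend n (f n) remainder i ≡ f i
  extend-remainder i≤n with m<1+n⇒m<n∨m≡n i≤n
  ... | inj₁ i<n  = trans (extend-< i<n) (punchIn-punchOut (lastDistinct i<n))
  ... | inj₂ refl = extend-last n (f n) remainder

-- If f (c + 1) < c, the values c + 1 and c both lie before the last position and exceed its entry.
lastEntry-large : ∀ {c f} → OntoBelow (suc (suc c)) f →
                  IsAvoidingDesarrangement (suc (suc c)) f → c ≤ f (suc c)
lastEntry-large {c} {f} onto ad with c ≤? f (suc c)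
... | yes c≤fn = c≤fn
... | no  c≰fn with onto (n<1+n (suc c)) | onto (m<n⇒m<1+n (n<1+n c))
...   | p , p≤n , fp≡1+c | q , q≤n , fq≡c = ⊥-elim (twoLargerBefore (<-cmp p q))
  where
    fn<c : f (suc c) < c
    fn<c = ≰⇒> c≰fn

    beforeLast : ∀ {i} → i < suc (suc c) → c ≤ f i → i < suc c
    beforeLast i≤n c≤fi with m<1+n⇒m<n∨m≡n i≤n
    ... | inj₁ i<n  = i<n
    ... | inj₂ refl = contradiction c≤fi (<⇒≱ fn<c)

    p<n : p < suc c
    p<n = beforeLast p≤n (subst (c ≤_) (sym fp≡1+c) (n≤1+n c))

    q<n : q < suc c
    q<n = beforeLast q≤n (subst (c ≤_) (sym fq≡c) ≤-refl)

    fn<fp : f (suc c) < f p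
    fn<fp = subst (f (suc c) <_) (sym fp≡1+c) (m<n⇒m<1+n fn<c)

    fn<fq : f (suc c) < f q
    fn<fq = subst (f (suc c) <_) (sym fq≡c) fn<c

    twoLargerBefore : Tri (p < q) (p ≡ q) (q < p) → ⊥
    twoLargerBefore (tri< p<q _ _) = ad .atMostOneLargerBefore p<q q<n (n<1+n (suc c)) fn<fp fn<fq
    twoLargerBefore (tri≈ _ refl _) = <-irrefl (trans (sym fq≡c) fp≡1+c) (n<1+n c)
    twoLargerBefore (tri> _ _ q<p) = ad .atMostOneLargerBefore q<p p<n (n<1+n (suc c)) fn<fq fn<fp

entry : ∀ {m k} → Vec (Fin m) k → ℕ → ℕ
entry []      _       = 0
entry (x ∷ _) zero    = toℕ x
entry (_ ∷ v) (suc i) = entry v i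

entry-lookup : ∀ {m k} (v : Vec (Fin m) k) (i : Fin k) → entry v (toℕ i) ≡ toℕ (lookup v i)
entry-lookup (x ∷ v) Fin.zero    = refl
entry-lookup (x ∷ v) (Fin.suc i) = entry-lookup v i

entry-fromℕ< : ∀ {m k} (v : Vec (Fin m) k) {i} (i<k : i < k) →
               entry v i ≡ toℕ (lookup v (fromℕ< i<k))
entry-fromℕ< v i<k = trans (cong (entry v) (sym (toℕ-fromℕ< i<k))) (entry-lookup v (fromℕ< i<k))

entry-< : ∀ {m k} (v : Vec (Fin m) k) {i} → i < k → entry v i < m
entry-< v i<k = subst (_< _) (sym (entry-fromℕ< v i<k)) (toℕ<n _)

entry-ext : ∀ {m k} (v w : Vec (Fin m) k) → (∀ {i} → i < k → entry v i ≡ entry w i) → v ≡ w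
entry-ext []      []      _  = refl
entry-ext (x ∷ v) (y ∷ w) eq
  with refl ← toℕ-injective (eq z<s) | refl ← entry-ext v w (eq ∘ s<s) = refl

fromSeq : ∀ {m} k (f : ℕ → ℕ) → (∀ {i} → i < k → f i < m) → Vec (Fin m) k
fromSeq zero    f _       = []
fromSeq (suc k) f bounded = fromℕ< (bounded z<s) ∷ fromSeq k (f ∘ suc) (bounded ∘ s<s)

entry-fromSeq : ∀ {m} k f (bounded : ∀ {i} → i < k → f i < m) {i} → i < k →
                entry (fromSeq k f bounded) i ≡ f i
entry-fromSeq (suc k) f bounded {zero}  _         = toℕ-fromℕ< (bounded z<s)
entry-fromSeq (suc k) f bounded {suc i} (s<s i<k) = entry-fromSeq k (f ∘ suc) (bounded ∘ s<s) i<k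

-- A value missed by v would let punchOut squeeze Fin n injectively into Fin (n - 1).
lookup-surjective : ∀ {n} (v : Word n) → IsPerm v → ∀ y → ∃ λ i → lookup v i ≡ y
lookup-surjective {suc n} v perm y with any? (λ i → lookup v i Fin.≟ y)
... | yes hit = hit
... | no  miss = contradiction (injective⇒≤ squeeze-injective) (<-irrefl refl)
  where
    missed : ∀ i → y ≢ lookup v i
    missed i y≡vi = miss (i , sym y≡vi)

    squeeze-injective : ∀ {i j} → Fin.punchOut (missed i) ≡ Fin.punchOut (missed j) → i ≡ j
    squeeze-injective {i} {j} eq = perm i j (punchOut-injective (missed i) (missed j) eq)

entry-onto : ∀ {n} (v : Word n) → IsPerm v → OntoBelow n (entry v)
entry-onto v perm y<n with lookup-surjective v perm (fromℕ< y<n)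
... | i , vi≡y = toℕ i , toℕ<n i , trans (entry-lookup v i) (trans (cong toℕ vi≡y) (toℕ-fromℕ< y<n))

module _ {n} (v : Word n) where

  private
    position-< : ∀ {i j} (i<n : i < n) (j<n : j < n) → i < j → fromℕ< i<n <ᶠ fromℕ< j<n
    position-< i<n j<n = subst₂ _<_ (sym (toℕ-fromℕ< i<n)) (sym (toℕ-fromℕ< j<n))

    value-< : ∀ {i j} (i<n : i < n) (j<n : j < n) → entry v i < entry v j →
              lookup v (fromℕ< i<n) <ᶠ lookup v (fromℕ< j<n)
    value-< i<n j<n = subst₂ _<_ (entry-fromℕ< v i<n) (entry-fromℕ< v j<n)

    entry-<ᶠ : ∀ {i j} → lookup v i <ᶠ lookup v j → entry v (toℕ i) < entry v (toℕ j)
    entry-<ᶠ {i} {j} = subst₂ _<_ (sym (entry-lookup v i)) (sym (entry-lookup v j))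

  isPerm⇔injective : IsPerm v ⇔ InjectiveOn n (entry v)
  isPerm⇔injective = mk⇔ to from
    where
      to : IsPerm v → InjectiveOn n (entry v)
      to perm i<n j<n vi≡vj = trans (sym (toℕ-fromℕ< i<n)) (trans (cong toℕ (perm _ _
        (toℕ-injective (trans (sym (entry-fromℕ< v i<n)) (trans vi≡vj (entry-fromℕ< v j<n))))))
        (toℕ-fromℕ< j<n))

      from : InjectiveOn n (entry v) → IsPerm v
      from injective i j vi≡vj = toℕ-injective (injective (toℕ<n i) (toℕ<n j)
        (trans (entry-lookup v i) (trans (cong toℕ vi≡vj) (sym (entry-lookup v j)))))

  isDescent⇔ : ∀ i → IsDescent v i ⇔ (suc (toℕ i) < n × entry v (suc (toℕ i)) < entry v (toℕ i))
  isDescent⇔ i = mk⇔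
    (λ (j , j≡1+i , vj<vi) → subst (_< n) j≡1+i (toℕ<n j) ,
       subst (λ t → entry v t < entry v (toℕ i)) j≡1+i (entry-<ᶠ vj<vi))
    (λ (1+i<n , descent) → fromℕ< 1+i<n , toℕ-fromℕ< 1+i<n ,
       subst₂ _<_ (entry-fromℕ< v 1+i<n) (entry-lookup v i) descent)

  avoids⇔atMostOneLargerBefore : InjectiveOn n (entry v) →
    (¬ Contains231 v × ¬ Contains321 v) ⇔ AtMostOneLargerBefore n (entry v)
  avoids⇔atMostOneLargerBefore injective = mk⇔ to from
    where
      to : ¬ Contains231 v × ¬ Contains321 v → AtMostOneLargerBefore n (entry v)
      to (no231 , no321) {i} {j} {k} i<j j<k k<n fk<fi fk<fj = occurrence (<-cmp (entry v i) (entry v j))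
        where
          i<n = proj₁ (<-below i<j j<k k<n)
          j<n = proj₂ (<-below i<j j<k k<n)

          occurrence : Tri (entry v i < entry v j) (entry v i ≡ entry v j) (entry v j < entry v i) → ⊥
          occurrence (tri< fi<fj _ _) = no231 (_ , _ , _ , position-< i<n j<n i<j , position-< j<n k<n j<k ,
                                              value-< k<n i<n fk<fi , value-< i<n j<n fi<fj)
          occurrence (tri≈ _ fi≡fj _) = <-irrefl (injective i<n j<n fi≡fj) i<j
          occurrence (tri> _ _ fj<fi) = no321 (_ , _ , _ , position-< i<n j<n i<j , position-< j<n k<n j<k ,
                                              value-< k<n j<n fk<fj , value-< j<n i<n fj<fi)

      from : AtMostOneLargerBefore n (entry v) → ¬ Contains231 v × ¬ Contains321 v
      from atMostOne =
        (λ (i , j , k , i<j , j<k , vk<vi , vi<vj) →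
           atMostOne i<j j<k (toℕ<n k) (entry-<ᶠ vk<vi) (<-trans (entry-<ᶠ vk<vi) (entry-<ᶠ vi<vj))) ,
        (λ (i , j , k , i<j , j<k , vk<vj , vj<vi) →
           atMostOne i<j j<k (toℕ<n k) (<-trans (entry-<ᶠ vk<vj) (entry-<ᶠ vj<vi)) (entry-<ᶠ vk<vj))

  desarrangement⇒startsWithDescent : IsDesarrangement v → 1 < n × entry v 1 < entry v 0
  desarrangement⇒startsWithDescent (Fin.zero  , _ , _     , 2∣1) = contradiction (∣1⇒≡1 2∣1) λ ()
  desarrangement⇒startsWithDescent (Fin.suc _ , _ , below , _)   =
    Equivalence.to (isDescent⇔ Fin.zero) (below Fin.zero z<s)

  startsWithDescent⇒desarrangement : (1<n : 1 < n) → AtMostOneLargerBefore n (entry v) →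
    entry v 1 < entry v 0 → IsDesarrangement v
  startsWithDescent⇒desarrangement 1<n atMostOne f1<f0 =
    second , ascent , firstDescent , subst (λ t → 2 ∣ suc t) (sym (toℕ-fromℕ< 1<n)) ∣-refl
    where
      second = fromℕ< 1<n

      ascent : IsAscent v second
      ascent descent with Equivalence.to (isDescent⇔ second) descent
      ... | 2<n , f2<f1 rewrite toℕ-fromℕ< 1<n =
        atMostOne z<s (s<s z<s) 2<n (<-trans f2<f1 f1<f0) f2<f1

      firstDescent : ∀ j → toℕ j < toℕ second → IsDescent v j
      firstDescent j j<1 with toℕ j | Equivalence.from (isDescent⇔ j)
      ... | zero | descent = descent (1<n , f1<f0)
      ... | suc _ | _ rewrite toℕ-fromℕ< 1<n = contradiction j<1 λ { (s≤s ()) }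

counted⇔IsAvoidingDesarrangement : ∀ {n} (v : Word n) → Counted v ⇔ IsAvoidingDesarrangement n (entry v)
counted⇔IsAvoidingDesarrangement {n} v = mk⇔ to from
  where
    to : Counted v → IsAvoidingDesarrangement n (entry v)
    to (perm , desarrangement , no231 , no321) = record
      { 1<n                   = proj₁ (desarrangement⇒startsWithDescent v desarrangement)
      ; injective             = entry-injective
      ; atMostOneLargerBefore = Equivalence.to (avoids⇔atMostOneLargerBefore v entry-injective) (no231 , no321)
      ; startsWithDescent     = proj₂ (desarrangement⇒startsWithDescent v desarrangement)
      }
      where entry-injective = Equivalence.to (isPerm⇔injective v) perm

    from : IsAvoidingDesarrangement n (entry v) → Counted v
    from ad = Equivalence.from (isPerm⇔injective v) (ad .injective) ,
              startsWithDescent⇒desarrangement v (ad .1<n) (ad .atMostOneLargerBefore) (ad .startsWithDescent) ,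
              Equivalence.from (avoids⇔atMostOneLargerBefore v (ad .injective)) (ad .atMostOneLargerBefore)

extendWord : ∀ {n} x → x < suc n → Word n → Word (suc n)
extendWord {n} x x≤n v = fromSeq (suc n) (extend n x (entry v)) (extend-bounded (entry-< v) x≤n)

module _ {n x} (x≤n : x < suc n) where

  entry-extendWord : ∀ (v : Word n) {i} → i < suc n → entry (extendWord x x≤n v) i ≡ extend n x (entry v) i
  entry-extendWord v = entry-fromSeq (suc n) (extend n x (entry v)) (extend-bounded (entry-< v) x≤n)

  lastEntry-extendWord : ∀ (v : Word n) → entry (extendWord x x≤n v) n ≡ x
  lastEntry-extendWord v = trans (entry-extendWord v (n<1+n n)) (extend-last n x (entry v))

  extendWord-injective : ∀ {v w : Word n} → extendWord x x≤n v ≡ extendWord x x≤n w → v ≡ w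
  extendWord-injective {v} {w} eq = entry-ext v w λ {i} i<n → punchIn-injective x (begin
    punchIn x (entry v i)          ≡⟨ extend-< i<n ⟨
    extend n x (entry v) i         ≡⟨ entry-extendWord v (m<n⇒m<1+n i<n) ⟨
    entry (extendWord x x≤n v) i   ≡⟨ cong (λ u → entry u i) eq ⟩
    entry (extendWord x x≤n w) i   ≡⟨ entry-extendWord w (m<n⇒m<1+n i<n) ⟩
    extend n x (entry w) i         ≡⟨ extend-< i<n ⟩
    punchIn x (entry w i)          ∎)
    where open ≡-Reasoning

  extendWord-IsAvoidingDesarrangement : n ≤ suc x → ∀ {v : Word n} →
    IsAvoidingDesarrangement n (entry v) → IsAvoidingDesarrangement (suc n) (entry (extendWord x x≤n v))
  extendWord-IsAvoidingDesarrangement n≤1+x {v} ad =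
    transport (pointwise-OrderPreservingOn (λ i≤n → sym (entry-extendWord v i≤n)))
              (extend-IsAvoidingDesarrangement (entry-< v) n≤1+x ad)

appendLargest : ∀ {n} → Word n → Word (suc n)
appendLargest {n} = extendWord n (n<1+n n)

appendSecondLargest : ∀ {n} → Word (suc n) → Word (suc (suc n))
appendSecondLargest {n} = extendWord n (m<n⇒m<1+n (n<1+n n))

appendLargest≢appendSecondLargest : ∀ {n} (v w : Word (suc n)) → appendLargest v ≢ appendSecondLargest w
appendLargest≢appendSecondLargest {n} v w eq = 1+n≢n (begin
  suc n                               ≡⟨ lastEntry-extendWord (n<1+n (suc n)) v ⟨
  entry (appendLargest v) (suc n)       ≡⟨ cong (λ u → entry u (suc n)) eq ⟩
  entry (appendSecondLargest w) (suc n) ≡⟨ lastEntry-extendWord (m<n⇒m<1+n (n<1+n n)) w ⟩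
  n                                   ∎)
  where open ≡-Reasoning

lastEntry-largest-or-secondLargest : ∀ {c} (v : Word (suc (suc c))) →
  IsAvoidingDesarrangement (suc (suc c)) (entry v) → entry v (suc c) ≡ suc c ⊎ entry v (suc c) ≡ c
lastEntry-largest-or-secondLargest {c} v ad with m<1+n⇒m<n∨m≡n (entry-< v (n<1+n (suc c)))
... | inj₂ last≡1+c = inj₁ last≡1+c
... | inj₁ last<1+c = inj₂ (≤-antisym (s≤s⁻¹ last<1+c) (lastEntry-large (entry-onto v perm) ad))
  where perm = Equivalence.from (isPerm⇔injective v) (ad .injective)

decompose : ∀ {n} (v : Word (suc n)) → 1 < n → IsAvoidingDesarrangement (suc n) (entry v) →
  ∃ λ w → IsAvoidingDesarrangement n (entry w) ×
          (∀ {x} (x≤n : x < suc n) → entry v n ≡ x → v ≡ extendWord x x≤n w)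
decompose {n} v 1<n ad = w , w-IsAvoidingDesarrangement , v≡extendWord
  where
    open Decomposition (entry-< v) ad

    w : Word n
    w = fromSeq n remainder remainder-bounded

    entry-w : ∀ {i} → i < n → entry w i ≡ remainder i
    entry-w = entry-fromSeq n remainder remainder-bounded

    w-IsAvoidingDesarrangement : IsAvoidingDesarrangement n (entry w)
    w-IsAvoidingDesarrangement =
      transport (pointwise-OrderPreservingOn (λ i<n → sym (entry-w i<n))) (remainder-IsAvoidingDesarrangement 1<n)

    v≡extendWord : ∀ {x} (x≤n : x < suc n) → entry v n ≡ x → v ≡ extendWord x x≤n w
    v≡extendWord x≤n refl = entry-ext v _ λ {i} i≤n → sym (begin
      entry (extendWord _ x≤n w) i      ≡⟨ entry-extendWord x≤n w i≤n ⟩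
      extend n (entry v n) (entry w) i  ≡⟨ extend-cong entry-w i≤n ⟩
      extend n (entry v n) remainder i  ≡⟨ extend-remainder i≤n ⟩
      entry v i                         ∎)
      where open ≡-Reasoning

base : Word 2
base = Fin.suc Fin.zero ∷ Fin.zero ∷ []

base-IsAvoidingDesarrangement : IsAvoidingDesarrangement 2 (entry base)
base-IsAvoidingDesarrangement = record
  { 1<n                   = s<s z<s
  ; injective             = injective₂
  ; atMostOneLargerBefore = λ i<j j<k k<2 _ _ → <⇒≱ k<2 (≤-trans (s≤s (≤-<-trans z≤n i<j)) j<k)
  ; startsWithDescent     = z<s
  }
  where
    injective₂ : InjectiveOn 2 (entry base)
    injective₂ {zero}        {zero}        _ _ _  = refl
    injective₂ {suc zero}    {suc zero}    _ _ _  = refl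
    injective₂ {zero}        {suc zero}    _ _ ()
    injective₂ {suc zero}    {zero}        _ _ ()
    injective₂ {suc (suc _)} (s<s (s<s ())) _ _
    injective₂ {_} {suc (suc _)} _ (s<s (s<s ())) _

only-base : ∀ (v : Word 2) → IsAvoidingDesarrangement 2 (entry v) → v ≡ base
only-base v ad = entry-ext v base entries
  where
    first≡1 : entry v 0 ≡ 1
    first≡1 = ≤-antisym (s≤s⁻¹ (entry-< v z<s)) (≤-<-trans z≤n (ad .startsWithDescent))

    entries : ∀ {i} → i < 2 → entry v i ≡ entry base i
    entries {zero}        _ = first≡1
    entries {suc zero}    _ = n<1⇒n≡0 (subst (entry v 1 <_) first≡1 (ad .startsWithDescent))
    entries {suc (suc _)} (s<s (s<s ()))

avoidingDesarrangements : ∀ m → List (Word (suc (suc m)))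
avoidingDesarrangements zero    = [ base ]
avoidingDesarrangements (suc m) =
  map appendLargest (avoidingDesarrangements m) ++ map appendSecondLargest (avoidingDesarrangements m)

avoidingDesarrangements-unique : ∀ m → Unique (avoidingDesarrangements m)
avoidingDesarrangements-unique zero    = All.[] ∷ []
avoidingDesarrangements-unique (suc m) =
  Unique.++⁺ (Unique.map⁺ (extendWord-injective _) (avoidingDesarrangements-unique m))
             (Unique.map⁺ (extendWord-injective _) (avoidingDesarrangements-unique m))
             disjoint
  where
    disjoint : ∀ {v} → v ∈ map appendLargest (avoidingDesarrangements m) ×
                       v ∈ map appendSecondLargest (avoidingDesarrangements m) → ⊥
    disjoint (v∈₁ , v∈₂) with (u , _ , refl) ← ∈-map⁻ appendLargest v∈₁
                            | (w , _ , eq) ← ∈-map⁻ appendSecondLargest v∈₂ =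
      appendLargest≢appendSecondLargest u w eq

length-avoidingDesarrangements : ∀ m → length (avoidingDesarrangements m) ≡ 2 ^ m
length-avoidingDesarrangements zero    = refl
length-avoidingDesarrangements (suc m) = begin
  length (map appendLargest ws ++ map appendSecondLargest ws)
    ≡⟨ length-++ (map appendLargest ws) ⟩
  length (map appendLargest ws) + length (map appendSecondLargest ws)
    ≡⟨ cong₂ _+_ (length-map appendLargest ws) (length-map appendSecondLargest ws) ⟩
  length ws + length ws
    ≡⟨ cong₂ _+_ (length-avoidingDesarrangements m) (length-avoidingDesarrangements m) ⟩
  2 ^ m + 2 ^ m
    ≡⟨ cong (2 ^ m +_) (+-identityʳ (2 ^ m)) ⟨
  2 ^ suc m ∎
  where
    open ≡-Reasoning
    ws = avoidingDesarrangements m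

∈-avoidingDesarrangements⇔ : ∀ m {v} → v ∈ avoidingDesarrangements m ⇔ IsAvoidingDesarrangement (suc (suc m)) (entry v)
∈-avoidingDesarrangements⇔ m {v} = mk⇔ (sound m) (complete m v)
  where
    sound : ∀ m {v} → v ∈ avoidingDesarrangements m → IsAvoidingDesarrangement (suc (suc m)) (entry v)
    sound zero    (here refl) = base-IsAvoidingDesarrangement
    sound (suc m) v∈ with ∈-++⁻ (map appendLargest (avoidingDesarrangements m)) v∈
    ... | inj₁ v∈₁ with (w , w∈ , refl) ← ∈-map⁻ appendLargest v∈₁ =
      extendWord-IsAvoidingDesarrangement _ (n≤1+n _) {w} (sound m w∈)
    ... | inj₂ v∈₂ with (w , w∈ , refl) ← ∈-map⁻ appendSecondLargest v∈₂ =
      extendWord-IsAvoidingDesarrangement _ ≤-refl {w} (sound m w∈)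

    complete : ∀ m v → IsAvoidingDesarrangement (suc (suc m)) (entry v) → v ∈ avoidingDesarrangements m
    complete zero    v ad = here (only-base v ad)
    complete (suc m) v ad with decompose v (s<s z<s) ad | lastEntry-largest-or-secondLargest v ad
    ... | w , w-ad , v≡ | inj₁ largest =
      ∈-++⁺ˡ (subst (_∈ map appendLargest (avoidingDesarrangements m)) (sym (v≡ _ largest))
                   (∈-map⁺ appendLargest (complete m w w-ad)))
    ... | w , w-ad , v≡ | inj₂ secondLargest =
      ∈-++⁺ʳ (map appendLargest (avoidingDesarrangements m))
             (subst (_∈ map appendSecondLargest (avoidingDesarrangements m)) (sym (v≡ _ secondLargest))
                    (∈-map⁺ appendSecondLargest (complete m w w-ad)))

theorem3p15 : ∀ (n : ℕ) → 2 ≤ n → d-231-321 n ≡ 2 ^ (n ∸ 2)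
theorem3p15 (suc zero)    (s≤s ())
theorem3p15 (suc (suc m)) _ = begin
  d-231-321 (suc (suc m))
    ≡⟨ d-231-321-≡-length _ (avoidingDesarrangements m) (avoidingDesarrangements-unique m)
         (λ {v} → ⇔-trans (∈-avoidingDesarrangements⇔ m) (⇔-sym (counted⇔IsAvoidingDesarrangement v))) ⟩
  length (avoidingDesarrangements m)
    ≡⟨ length-avoidingDesarrangements m ⟩
  2 ^ m ∎
  where open ≡-Reasoning
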